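{- Let $G$ be a connected graph of order $n\ge 2$ and let $H$ be a non-trivial graph. If no adjacency basis for $H$ is a dominating set of $H$, then $$\operatorname{dim}_A(G\odot H)=n\cdot \operatorname{dim}_A(H)+n-1.$$
   Context: All graphs are finite, simple, undirected; non-trivial means order at least 2. A set $S\subseteq V(H)$ is an adjacency generator for $H$ if for every two distinct $x,y\in V(H)\setminus S$ there exists $s\in S$ with $|N_H(s)\cap\{x,y\}|=1$ ($N_H$ the open neighbourhood); an adjacency basis is an adjacency generator of minimum cardinality, and this cardinality is $\operatorname{dim}_A(H)$. A dominating set $D$ satisfies $\bigcup_{v\in D}N_H[v]=V(H)$. The corona product $G\odot H$ ($G$ of order $n$ with vertices $v_1,\dots,v_n$) consists of $G$ and $n$ disjoint copies $H_1,\dots,H_n$ of $H$, with $v_i$ joined to every vertex of $H_i$. -}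

module Defs where

open import Data.Nat using (ℕ; zero; suc; _+_; _*_; _≤_)
open import Data.Bool using (Bool; true; false; _∨_)
open import Data.Fin using (Fin; splitAt; _↑ˡ_; _↑ʳ_; remQuot; combine)
open import Data.Fin.Subset using (Subset; _∈_; _∉_; ∣_∣)
open import Data.Sum using (_⊎_; inj₁; inj₂)
open import Data.Product using (_×_; _,_; ∃; ∃-syntax; Σ)
open import Data.Empty using (⊥)
open import Relation.Binary.PropositionalEquality using (_≡_; _≢_)
open import Relation.Nullary using (¬_)
open import Data.Fin using (_≟_)
open import Relation.Nullary.Decidable using (⌊_⌋)

record Graph (n : ℕ) : Set where
  field
    adj   : Fin n → Fin n → Bool
    sym   : ∀ u v → adj u v ≡ adj v u
    irrefl : ∀ v → adj v v ≡ false
open Graph public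

Adj : ∀ {n} → Graph n → Fin n → Fin n → Set
Adj G u v = adj G u v ≡ true

data Walk {n} (G : Graph n) : Fin n → Fin n → Set where
  here : ∀ {u} → Walk G u u
  step : ∀ {u v w} → Adj G u v → Walk G v w → Walk G u w

Connected : ∀ {n} → Graph n → Set
Connected G = ∀ u v → Walk G u v

IsAdjacencyGenerator : ∀ {n} → Graph n → Subset n → Set
IsAdjacencyGenerator G S =
  ∀ x y → x ≢ y → x ∉ S → y ∉ S →
    ∃[ s ] (s ∈ S × ((Adj G s x × ¬ Adj G s y) ⊎ (¬ Adj G s x × Adj G s y)))

IsAdjacencyBasis : ∀ {n} → Graph n → Subset n → Set
IsAdjacencyBasis G S =
  IsAdjacencyGenerator G S × (∀ T → IsAdjacencyGenerator G T → ∣ S ∣ ≤ ∣ T ∣)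

AdjacencyDimension : ∀ {n} → Graph n → ℕ → Set
AdjacencyDimension G d = ∃[ S ] (IsAdjacencyBasis G S × ∣ S ∣ ≡ d)

IsDominating : ∀ {n} → Graph n → Subset n → Set
IsDominating G D = ∀ v → v ∈ D ⊎ ∃[ u ] (u ∈ D × Adj G u v)

-- Corona product G ⊙ H, vertex set Fin (n + n * m):
-- the first n vertices are those of G (vertex i = v_i),
-- vertex  n ↑ʳ combine i j  is the copy of vertex j of H in H_i.
data CVert (n m : ℕ) : Set where
  gV : Fin n → CVert n m
  hV : Fin n → Fin m → CVert n m

cview : ∀ {n m} → Fin (n + n * m) → CVert n m
cview {n} {m} x with splitAt n x
... | inj₁ i = gV i
... | inj₂ k with remQuot {n} m k
...   | (i , j) = hV i j

coronaAdj : ∀ {n m} → Graph n → Graph m → CVert n m → CVert n m → Bool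
coronaAdj G H (gV i) (gV i') = adj G i i'
coronaAdj G H (gV i) (hV i' j) = ⌊ i ≟ i' ⌋
coronaAdj G H (hV i j) (gV i') = ⌊ i ≟ i' ⌋
coronaAdj G H (hV i j) (hV i' j') = ⌊ i ≟ i' ⌋ Data.Bool.∧ adj H j j'
  where import Data.Bool

private
  open import Relation.Binary.PropositionalEquality using (refl; cong; cong₂)
  open import Data.Bool using (_∧_)
  open import Data.Bool.Properties using (∧-comm)
  open import Relation.Nullary using (yes; no)

  eqsym : ∀ {n} (i j : Fin n) → ⌊ i ≟ j ⌋ ≡ ⌊ j ≟ i ⌋
  eqsym i j with i ≟ j | j ≟ i
  ... | yes _ | yes _ = refl
  ... | no _ | no _ = refl
  ... | yes p | no q = Data.Empty.⊥-elim (q (Relation.Binary.PropositionalEquality.sym p))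
    where import Data.Empty
  ... | no p | yes q = Data.Empty.⊥-elim (p (Relation.Binary.PropositionalEquality.sym q))
    where import Data.Empty

  eqrefl : ∀ {n} (i : Fin n) → ⌊ i ≟ i ⌋ ≡ true
  eqrefl i with i ≟ i
  ... | yes _ = refl
  ... | no q = Data.Empty.⊥-elim (q refl)
    where import Data.Empty

  csym : ∀ {n m} (G : Graph n) (H : Graph m) u v → coronaAdj G H u v ≡ coronaAdj G H v u
  csym G H (gV i) (gV i') = Graph.sym G i i'
  csym G H (gV i) (hV i' j) = eqsym i i'
  csym G H (hV i j) (gV i') = eqsym i i'
  csym G H (hV i j) (hV i' j') = cong₂ _∧_ (eqsym i i') (Graph.sym H j j')

  cirr : ∀ {n m} (G : Graph n) (H : Graph m) u → coronaAdj G H u u ≡ false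
  cirr G H (gV i) = Graph.irrefl G i
  cirr G H (hV i j) rewrite eqrefl i = Graph.irrefl H j

_⊙_ : ∀ {n m} → Graph n → Graph m → Graph (n + n * m)
G ⊙ H = record
  { adj = λ x y → coronaAdj G H (cview x) (cview y)
  ; sym = λ x y → csym G H (cview x) (cview y)
  ; irrefl = λ x → cirr G H (cview x)
  }

-- Write v₁, …, vₙ for the vertices of G and Tᵢ for the trace of a set T on the copy Hᵢ.
-- Upper bound: V(G) ∖ {v₁} together with a copy of an adjacency basis B of H in every Hᵢ
-- is an adjacency generator; inside Hᵢ the copy of B separates, and any other pair is
-- separated by a vertex of G or of B₁ (B is nonempty and v₁ has a neighbour in G).
-- Lower bound: for an adjacency generator T of G ⊙ H every Tᵢ is an adjacency generator
-- of H, so |T ∩ ({vᵢ} ∪ Hᵢ)| ≥ dim_A(H), with equality only if vᵢ ∉ T and Tᵢ is a basis.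
-- A basis does not dominate H, so such a copy has a vertex xᵢ with no neighbour in Tᵢ.
-- Two such copies i ≠ j are impossible: the only vertices adjacent to xᵢ or xⱼ are vᵢ,
-- vⱼ and neighbours inside Tᵢ, Tⱼ, none of which lies in T, so T does not separate them.
-- Hence at most one copy contributes dim_A(H) and all others at least dim_A(H) + 1.
module Submission where

open import Defs hiding (sym)
open import Data.Nat using (ℕ; zero; suc; _+_; _*_; _∸_; _≤_; _<_; s≤s; z≤n; _<?_)
open import Data.Nat.Properties
  using (≤-trans; ≤-reflexive; +-mono-≤; +-identityʳ; +-assoc; m≤n+m; n≤1+n; ≮⇒≥)
open import Data.Nat.Solver using (module +-*-Solver)
open import Data.Bool using (Bool; true; false)
open import Data.Bool.Properties using (¬-not; not-¬)
import Data.Bool.Properties as Bool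
open import Data.Fin using (Fin; zero; suc; _≟_; _↑ˡ_; _↑ʳ_; splitAt; combine; join)
open import Data.Fin.Properties
  using (suc-injective; splitAt-↑ˡ; splitAt-↑ʳ; join-splitAt; remQuot-combine; combine-remQuot; ¬∀⟶∃¬; any?)
open import Data.Fin.Subset using (Subset; _∈_; _∉_; ∣_∣)
open import Data.Fin.Subset.Properties using (_∈?_)
open import Data.Vec using (_∷_; []; lookup; tabulate)
open import Data.Vec.Properties using (lookup∘tabulate; tabulate∘lookup; tabulate-cong; []=⇒lookup; lookup⇒[]=)
open import Data.Sum using (_⊎_; inj₁; inj₂)
open import Data.Product using (_×_; _,_; ∃-syntax)
open import Data.Empty using (⊥; ⊥-elim)
open import Function using (_∘_)
open import Relation.Nullary using (¬_; yes; no; contradiction)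
open import Relation.Nullary.Decidable using (⌊_⌋; _⊎-dec_; _×-dec_)
open import Relation.Binary.PropositionalEquality

∑ : ∀ k → (Fin k → ℕ) → ℕ
∑ zero    f = 0
∑ (suc k) f = f zero + ∑ k (f ∘ suc)

∑-cong : ∀ k {f g : Fin k → ℕ} → f ≗ g → ∑ k f ≡ ∑ k g
∑-cong zero    f≗g = refl
∑-cong (suc k) f≗g = cong₂ _+_ (f≗g zero) (∑-cong k (f≗g ∘ suc))

∑-const : ∀ k c → ∑ k (λ _ → c) ≡ k * c
∑-const zero    c = refl
∑-const (suc k) c = cong (c +_) (∑-const k c)

∑-+ : ∀ k (f g : Fin k → ℕ) → ∑ k (λ i → f i + g i) ≡ ∑ k f + ∑ k g
∑-+ zero    f g = refl
∑-+ (suc k) f g rewrite ∑-+ k (f ∘ suc) (g ∘ suc) =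
  solve 4 (λ a b c d → (a :+ b) :+ (c :+ d) := (a :+ c) :+ (b :+ d)) refl
    (f zero) (g zero) (∑ k (f ∘ suc)) (∑ k (g ∘ suc))
  where open +-*-Solver using (solve; _:+_; _:=_)

∑-↑ : ∀ a b (f : Fin (a + b) → ℕ) → ∑ (a + b) f ≡ ∑ a (f ∘ (_↑ˡ b)) + ∑ b (f ∘ (a ↑ʳ_))
∑-↑ zero    b f = refl
∑-↑ (suc a) b f rewrite ∑-↑ a b (f ∘ suc) = sym (+-assoc (f zero) _ _)

∑-combine : ∀ a b (f : Fin (a * b) → ℕ) → ∑ (a * b) f ≡ ∑ a (λ i → ∑ b (λ j → f (combine i j)))
∑-combine zero    b f = refl
∑-combine (suc a) b f rewrite ∑-↑ b (a * b) f | ∑-combine a b (f ∘ (b ↑ʳ_)) = refl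

*≤∑ : ∀ k e (c : Fin k → ℕ) → (∀ i → e ≤ c i) → k * e ≤ ∑ k c
*≤∑ zero    e c e≤c = z≤n
*≤∑ (suc k) e c e≤c = +-mono-≤ (e≤c zero) (*≤∑ k e (c ∘ suc) (e≤c ∘ suc))

*+∸1≤∑ : ∀ k d (c : Fin k → ℕ) → (∀ i → d ≤ c i) → (∀ i j → i ≢ j → d < c i ⊎ d < c j) →
         k * d + (k ∸ 1) ≤ ∑ k c
*+∸1≤∑ zero    d c d≤c one-tight = z≤n
*+∸1≤∑ (suc k) d c d≤c one-tight with d <? c zero
... | yes d<c₀ = ≤-trans (shift k) (+-mono-≤ d<c₀ (*+∸1≤∑ k d (c ∘ suc) (d≤c ∘ suc) one-tight′))
  where
  open +-*-Solver using (solve; _:+_; _:*_; _:=_; con)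
  one-tight′ : ∀ i j → i ≢ j → d < c (suc i) ⊎ d < c (suc j)
  one-tight′ i j i≢j = one-tight (suc i) (suc j) (i≢j ∘ suc-injective)
  shift : ∀ k → suc k * d + k ≤ suc d + (k * d + (k ∸ 1))
  shift zero    = ≤-trans (≤-reflexive (+-identityʳ _)) (n≤1+n _)
  shift (suc k) = ≤-reflexive (solve 2 (λ d k → (d :+ (con 1 :+ k) :* d) :+ (con 1 :+ k)
                                              := con 1 :+ d :+ ((con 1 :+ k) :* d :+ k)) refl d k)
... | no d≮c₀ = ≤-trans (≤-reflexive rearrange) (+-mono-≤ (d≤c zero) (*≤∑ k (suc d) (c ∘ suc) others))
  where
  open +-*-Solver using (solve; _:+_; _:*_; _:=_; con)
  others : ∀ i → d < c (suc i)
  others i with one-tight zero (suc i) (λ ())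
  ... | inj₁ d<c₀ = contradiction d<c₀ d≮c₀
  ... | inj₂ d<cᵢ = d<cᵢ
  rearrange : suc k * d + k ≡ d + k * suc d
  rearrange = solve 2 (λ d k → (d :+ k :* d) :+ k := d :+ k :* (con 1 :+ d)) refl d k

⟦_⟧ : Bool → ℕ
⟦ true  ⟧ = 1
⟦ false ⟧ = 0

∣∣≡∑ : ∀ {k} (S : Subset k) → ∣ S ∣ ≡ ∑ k (⟦_⟧ ∘ lookup S)
∣∣≡∑ []          = refl
∣∣≡∑ (true ∷ S)  = cong suc (∣∣≡∑ S)
∣∣≡∑ (false ∷ S) = ∣∣≡∑ S

lookup-∉ : ∀ {k} {x : Fin k} {S : Subset k} → x ∉ S → lookup S x ≡ false
lookup-∉ {x = x} {S} x∉S = ¬-not (x∉S ∘ lookup⇒[]= x S)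

lookup-false⇒∉ : ∀ {k} {x : Fin k} {S : Subset k} → lookup S x ≡ false → x ∉ S
lookup-false⇒∉ Sx≡false x∈S = not-¬ Sx≡false ([]=⇒lookup x∈S)

∈-tabulate : ∀ {k} {f : Fin k → Bool} {x} → f x ≡ true → x ∈ tabulate f
∈-tabulate {f = f} {x} fx≡true = lookup⇒[]= x (tabulate f) (trans (lookup∘tabulate f x) fx≡true)

∉-tabulate : ∀ {k} {f : Fin k → Bool} {x} → x ∉ tabulate f → f x ≡ false
∉-tabulate {f = f} {x} x∉ = trans (sym (lookup∘tabulate f x)) (lookup-∉ x∉)

⌊≟⌋-refl : ∀ {k} (i : Fin k) → ⌊ i ≟ i ⌋ ≡ true
⌊≟⌋-refl i with i ≟ i
... | yes _   = refl
... | no i≢i = contradiction refl i≢i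

Separates : ∀ {V : Set} → (V → V → Set) → V → V → V → Set
Separates _~_ s x y = (s ~ x × ¬ s ~ y) ⊎ (¬ s ~ x × s ~ y)

Separates-sym : ∀ {V : Set} (_~_ : V → V → Set) {s x y} → Separates _~_ s x y → Separates _~_ s y x
Separates-sym _ (inj₁ (s~x , s≁y)) = inj₂ (s≁y , s~x)
Separates-sym _ (inj₂ (s≁x , s~y)) = inj₁ (s~y , s≁x)

adjacencyGenerator-nonempty : ∀ {m} (H : Graph (suc (suc m))) {B} →
  IsAdjacencyGenerator H B → ∃[ u ] u ∈ B
adjacencyGenerator-nonempty H {B} gen with zero ∈? B | suc zero ∈? B
... | yes 0∈B | _       = zero , 0∈B
... | no _    | yes 1∈B = suc zero , 1∈B
... | no 0∉B  | no 1∉B  = let s , s∈B , _ = gen zero (suc zero) (λ ()) 0∉B 1∉B in s , s∈B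

walk-neighbour : ∀ {n} {G : Graph n} {u v} → Walk G u v → u ≢ v → ∃[ w ] Adj G u w
walk-neighbour here         u≢u = contradiction refl u≢u
walk-neighbour (step u~w _) _   = _ , u~w

¬dominating⇒undominated : ∀ {m} (H : Graph m) (D : Subset m) → ¬ IsDominating H D →
  ∃[ x ] (x ∉ D × ∀ u → u ∈ D → ¬ Adj H u x)
¬dominating⇒undominated {m} H D ¬dom
  with ¬∀⟶∃¬ m _ (λ v → (v ∈? D) ⊎-dec any? (λ u → (u ∈? D) ×-dec (adj H u v Bool.≟ true))) ¬dom
... | x , x-undominated = x , x-undominated ∘ inj₁ , λ u u∈D u~x → x-undominated (inj₂ (u , u∈D , u~x))

module Corona {n m} (G : Graph n) (H : Graph m) where

  V : Set
  V = CVert n m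

  _~_ : V → V → Set
  s ~ x = coronaAdj G H s x ≡ true

  vertex : V → Fin (n + n * m)
  vertex (gV i)   = i ↑ˡ (n * m)
  vertex (hV i j) = n ↑ʳ combine i j

  cview-vertex : ∀ c → cview (vertex c) ≡ c
  cview-vertex (gV i)   rewrite splitAt-↑ˡ n i (n * m) = refl
  cview-vertex (hV i j) rewrite splitAt-↑ʳ n (n * m) (combine i j) =
    cong (λ (i , j) → hV i j) (remQuot-combine {n} {m} i j)

  vertex-cview : ∀ x → vertex (cview x) ≡ x
  vertex-cview x with splitAt n x in eq
  ... | inj₁ i = trans (cong (join n (n * m)) (sym eq)) (join-splitAt n (n * m) x)
  ... | inj₂ k = trans (cong (n ↑ʳ_) (combine-remQuot {n} m k))
                       (trans (cong (join n (n * m)) (sym eq)) (join-splitAt n (n * m) x))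

  IsGenerator : (V → Bool) → Set
  IsGenerator P = ∀ x y → x ≢ y → P x ≡ false → P y ≡ false →
    ∃[ s ] (P s ≡ true × Separates _~_ s x y)

  member : Subset (n + n * m) → V → Bool
  member S = lookup S ∘ vertex

  toSubset : (V → Bool) → Subset (n + n * m)
  toSubset P = tabulate (P ∘ cview)

  member-toSubset : ∀ P c → member (toSubset P) c ≡ P c
  member-toSubset P c = trans (lookup∘tabulate (P ∘ cview) (vertex c)) (cong P (cview-vertex c))

  member-isGenerator : ∀ {S} → IsAdjacencyGenerator (G ⊙ H) S → IsGenerator (member S)
  member-isGenerator {S} gen x y x≢y Sx≡false Sy≡false
    with gen (vertex x) (vertex y) (x≢y ∘ vertex-injective) (lookup-false⇒∉ Sx≡false) (lookup-false⇒∉ Sy≡false)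
    where
    vertex-injective : vertex x ≡ vertex y → x ≡ y
    vertex-injective eq = trans (sym (cview-vertex x)) (trans (cong cview eq) (cview-vertex y))
  ... | s , s∈S , sep = cview s , trans (cong (lookup S) (vertex-cview s)) ([]=⇒lookup s∈S) ,
                        subst₂ (Separates _~_ (cview s)) (cview-vertex x) (cview-vertex y) sep

  toSubset-isGenerator : ∀ {P} → IsGenerator P → IsAdjacencyGenerator (G ⊙ H) (toSubset P)
  toSubset-isGenerator {P} gen x y x≢y x∉ y∉
    with gen (cview x) (cview y) (x≢y ∘ cview-injective) (∉-tabulate x∉) (∉-tabulate y∉)
    where
    cview-injective : cview x ≡ cview y → x ≡ y
    cview-injective eq = trans (sym (vertex-cview x)) (trans (cong vertex eq) (vertex-cview y))
  ... | s , Ps , sep = vertex s , ∈-tabulate (trans (cong P (cview-vertex s)) Ps) ,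
                       subst (λ t → Separates _~_ t (cview x) (cview y)) (sym (cview-vertex s)) sep

  copy : (V → Bool) → Fin n → Subset m
  copy P i = tabulate (λ j → P (hV i j))

  ∣copy∣≡∑ : ∀ P i → ∣ copy P i ∣ ≡ ∑ m (λ j → ⟦ P (hV i j) ⟧)
  ∣copy∣≡∑ P i = trans (∣∣≡∑ (copy P i)) (∑-cong m (cong ⟦_⟧ ∘ lookup∘tabulate (λ j → P (hV i j))))

  ∣∣≡∑-copies : ∀ (S : Subset (n + n * m)) →
    ∣ S ∣ ≡ ∑ n (λ i → ⟦ member S (gV i) ⟧ + ∣ copy (member S) i ∣)
  ∣∣≡∑-copies S = begin
    ∣ S ∣
      ≡⟨ ∣∣≡∑ S ⟩
    ∑ (n + n * m) (⟦_⟧ ∘ lookup S)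
      ≡⟨ ∑-↑ n (n * m) _ ⟩
    ∑ n (⟦_⟧ ∘ root) + ∑ (n * m) (⟦_⟧ ∘ lookup S ∘ (n ↑ʳ_))
      ≡⟨ cong (∑ n (⟦_⟧ ∘ root) +_) (∑-combine n m _) ⟩
    ∑ n (⟦_⟧ ∘ root) + ∑ n (λ i → ∑ m (λ j → ⟦ member S (hV i j) ⟧))
      ≡⟨ sym (∑-+ n _ _) ⟩
    ∑ n (λ i → ⟦ root i ⟧ + ∑ m (λ j → ⟦ member S (hV i j) ⟧))
      ≡⟨ ∑-cong n (λ i → cong (⟦ root i ⟧ +_) (sym (∣copy∣≡∑ (member S) i))) ⟩
    ∑ n (λ i → ⟦ root i ⟧ + ∣ copy (member S) i ∣)
      ∎
    where
    open ≡-Reasoning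
    root : Fin n → Bool
    root i = member S (gV i)

  ∣toSubset∣ : ∀ P → ∣ toSubset P ∣ ≡ ∑ n (λ i → ⟦ P (gV i) ⟧ + ∣ copy P i ∣)
  ∣toSubset∣ P = trans (∣∣≡∑-copies (toSubset P)) (∑-cong n same-summand)
    where
    same-summand : ∀ i → ⟦ member (toSubset P) (gV i) ⟧ + ∣ copy (member (toSubset P)) i ∣
                       ≡ ⟦ P (gV i) ⟧ + ∣ copy P i ∣
    same-summand i = cong₂ (λ b C → ⟦ b ⟧ + ∣ C ∣) (member-toSubset P (gV i))
                                                  (tabulate-cong (member-toSubset P ∘ hV i))

  hV-neighbour : ∀ s i x → s ~ hV i x → s ≡ gV i ⊎ ∃[ l ] (s ≡ hV i l × Adj H l x)
  hV-neighbour (gV k) i x s~x with k ≟ i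
  ... | yes refl = inj₁ refl
  hV-neighbour (gV k) i x () | no _
  hV-neighbour (hV k l) i x s~x with k ≟ i
  ... | yes refl = inj₂ (l , refl , s~x)
  hV-neighbour (hV k l) i x () | no _

  -- The root vᵢ and every other copy see x and y alike.
  copy-separator : ∀ s i x y → Separates _~_ s (hV i x) (hV i y) →
    ∃[ l ] (s ≡ hV i l × Separates (Adj H) l x y)
  copy-separator (gV k) i x y (inj₁ (s~x , s≁y)) = contradiction s~x s≁y
  copy-separator (gV k) i x y (inj₂ (s≁x , s~y)) = contradiction s~y s≁x
  copy-separator (hV k l) i x y sep with k ≟ i
  ... | yes refl = l , refl , sep
  copy-separator (hV k l) i x y (inj₁ (() , _)) | no _
  copy-separator (hV k l) i x y (inj₂ (_ , ())) | no _

  copy-isGenerator : ∀ {P} → IsGenerator P → ∀ i → IsAdjacencyGenerator H (copy P i)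
  copy-isGenerator {P} gen i x y x≢y x∉ y∉
    with gen (hV i x) (hV i y) (λ { refl → x≢y refl }) (∉-tabulate x∉) (∉-tabulate y∉)
  ... | s , Ps , sep with copy-separator s i x y sep
  ...   | l , refl , sepₗ = l , ∈-tabulate Ps , sepₗ

  copy-separates : ∀ i {l x y} → Separates (Adj H) l x y → Separates _~_ (hV i l) (hV i x) (hV i y)
  copy-separates i sep rewrite ⌊≟⌋-refl i = sep

  root-separates : ∀ {i k} j l → i ≢ k → Separates _~_ (gV i) (hV i j) (hV k l)
  root-separates {i} {k} j l i≢k with i ≟ k
  ... | yes i≡k = contradiction i≡k i≢k
  ... | no _    = inj₁ (⌊≟⌋-refl i , λ ())

  Lonely : (V → Bool) → Fin n → Set
  Lonely P i = P (gV i) ≡ false × ¬ IsDominating H (copy P i)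

  lonely-unseen : ∀ P i {x} → P (gV i) ≡ false → (∀ u → u ∈ copy P i → ¬ Adj H u x) →
    ∀ s → P s ≡ true → ¬ s ~ hV i x
  lonely-unseen P i {x} Pvᵢ x-lonely s Ps s~x with hV-neighbour s i x s~x
  ... | inj₁ refl             = not-¬ Pvᵢ Ps
  ... | inj₂ (l , refl , l~x) = x-lonely l (∈-tabulate Ps) l~x

  lonely-unique : ∀ {P} → IsGenerator P → ∀ i j → i ≢ j → Lonely P i → Lonely P j → ⊥
  lonely-unique {P} gen i j i≢j (Pvᵢ , ¬domᵢ) (Pvⱼ , ¬domⱼ)
    with ¬dominating⇒undominated H (copy P i) ¬domᵢ | ¬dominating⇒undominated H (copy P j) ¬domⱼ
  ... | xᵢ , xᵢ∉ , xᵢ-lonely | xⱼ , xⱼ∉ , xⱼ-lonely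
    with gen (hV i xᵢ) (hV j xⱼ) (λ { refl → i≢j refl }) (∉-tabulate xᵢ∉) (∉-tabulate xⱼ∉)
  ... | s , Ps , inj₁ (s~xᵢ , _) = lonely-unseen P i Pvᵢ xᵢ-lonely s Ps s~xᵢ
  ... | s , Ps , inj₂ (_ , s~xⱼ) = lonely-unseen P j Pvⱼ xⱼ-lonely s Ps s~xⱼ

module _ {n m} (G : Graph n) (H : Graph m) where
  open Corona G H

  *+∸1≤∣adjacencyGenerator∣ : ∀ d → (∀ T → IsAdjacencyGenerator H T → d ≤ ∣ T ∣) →
    (∀ B → IsAdjacencyBasis H B → ¬ IsDominating H B) →
    ∀ S → IsAdjacencyGenerator (G ⊙ H) S → n * d + (n ∸ 1) ≤ ∣ S ∣
  *+∸1≤∣adjacencyGenerator∣ d d-min no-dominating-basis S S-gen =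
    ≤-trans (*+∸1≤∑ n d c d≤c at-most-one-tight) (≤-reflexive (sym (∣∣≡∑-copies S)))
    where
    P : V → Bool
    P = member S
    P-gen : IsGenerator P
    P-gen = member-isGenerator S-gen
    c : Fin n → ℕ
    c i = ⟦ P (gV i) ⟧ + ∣ copy P i ∣
    d≤∣copy∣ : ∀ i → d ≤ ∣ copy P i ∣
    d≤∣copy∣ i = d-min _ (copy-isGenerator P-gen i)
    d≤c : ∀ i → d ≤ c i
    d≤c i = ≤-trans (d≤∣copy∣ i) (m≤n+m _ _)
    tight⇒lonely : ∀ i → ¬ d < c i → Lonely P i
    tight⇒lonely i d≮c with P (gV i)
    ... | true  = contradiction (s≤s (d≤∣copy∣ i)) d≮c
    ... | false = refl , no-dominating-basis (copy P i) (copy-isGenerator P-gen i , minimal)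
      where
      minimal : ∀ T → IsAdjacencyGenerator H T → ∣ copy P i ∣ ≤ ∣ T ∣
      minimal T T-gen = ≤-trans (≮⇒≥ d≮c) (d-min T T-gen)
    at-most-one-tight : ∀ i j → i ≢ j → d < c i ⊎ d < c j
    at-most-one-tight i j i≢j with d <? c i | d <? c j
    ... | yes d<cᵢ | _        = inj₁ d<cᵢ
    ... | no _     | yes d<cⱼ = inj₂ d<cⱼ
    ... | no d≮cᵢ  | no d≮cⱼ  =
      ⊥-elim (lonely-unique P-gen i j i≢j (tight⇒lonely i d≮cᵢ) (tight⇒lonely j d≮cⱼ))

module _ {n m} (G : Graph (suc n)) (H : Graph m) where
  open Corona G H

  rootless : Subset m → V → Bool
  rootless B (gV zero)    = false
  rootless B (gV (suc _)) = true
  rootless B (hV _ j)     = lookup B j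

  ∣rootless∣ : ∀ B → ∣ toSubset (rootless B) ∣ ≡ suc n * ∣ B ∣ + n
  ∣rootless∣ B = begin
    ∣ toSubset (rootless B) ∣
      ≡⟨ ∣toSubset∣ (rootless B) ⟩
    ∑ (suc n) (λ i → ⟦ rootless B (gV i) ⟧ + ∣ copy (rootless B) i ∣)
      ≡⟨ ∑-cong (suc n) (λ i → cong (λ C → ⟦ rootless B (gV i) ⟧ + ∣ C ∣) (tabulate∘lookup B)) ⟩
    ∣ B ∣ + ∑ n (λ _ → suc ∣ B ∣)
      ≡⟨ cong (∣ B ∣ +_) (∑-const n (suc ∣ B ∣)) ⟩
    ∣ B ∣ + n * suc ∣ B ∣
      ≡⟨ solve 2 (λ b n → b :+ n :* (con 1 :+ b) := (con 1 :+ n) :* b :+ n) refl ∣ B ∣ n ⟩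
    suc n * ∣ B ∣ + n
      ∎
    where
    open ≡-Reasoning
    open +-*-Solver using (solve; _:+_; _:*_; _:=_; con)

  rootless-isGenerator : ∀ {B} → IsAdjacencyGenerator H B → ∃[ u ] u ∈ B →
    ∃[ w ] Adj G zero w → IsGenerator (rootless B)
  rootless-isGenerator B-gen _          (zero , 0~0)  = contradiction (trans (sym 0~0) (irrefl G zero)) λ ()
  rootless-isGenerator {B} B-gen (u , u∈B) (suc w , 0~w) = separate
    where
    root-vs-copy : ∀ i j → ∃[ s ] (rootless B s ≡ true × Separates _~_ s (gV zero) (hV i j))
    root-vs-copy zero    j = gV (suc w) , refl , inj₁ (trans (Graph.sym G (suc w) zero) 0~w , λ ())
    root-vs-copy (suc i) j = hV zero u , []=⇒lookup u∈B , inj₁ (refl , λ ())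
    across : ∀ i k j l → i ≢ k → ∃[ s ] (rootless B s ≡ true × Separates _~_ s (hV i j) (hV k l))
    across (suc i) k       j l i≢k = gV (suc i) , refl , root-separates j l i≢k
    across zero    (suc k) j l i≢k = gV (suc k) , refl ,
      Separates-sym _~_ {gV (suc k)} {hV (suc k) l} {hV zero j} (root-separates {k = zero} l j (λ ()))
    across zero    zero    j l i≢k = contradiction refl i≢k
    separate : IsGenerator (rootless B)
    separate (gV zero) (gV zero) x≢y _ _ = contradiction refl x≢y
    separate (gV zero) (hV i j)  _ _ _ = root-vs-copy i j
    separate (hV i j)  (gV zero) _ _ _ = let s , Bs , sep = root-vs-copy i j in s , Bs , Separates-sym _~_ {s} sep
    separate (hV i j)  (hV k l)  x≢y Bj Bl with i ≟ k
    ... | no i≢k   = across i k j l i≢k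
    ... | yes refl with B-gen j l (λ { refl → x≢y refl }) (lookup-false⇒∉ Bj) (lookup-false⇒∉ Bl)
    ...   | s , s∈B , sep = hV i s , []=⇒lookup s∈B , copy-separates i sep

theorem10 : ∀ {n m} (G : Graph n) (H : Graph m) → 2 ≤ n → Connected G → 2 ≤ m →
    (∀ B → IsAdjacencyBasis H B → ¬ IsDominating H B) →
    ∀ d → AdjacencyDimension H d → AdjacencyDimension (G ⊙ H) (n * d + (n ∸ 1))
theorem10 {suc (suc n)} {suc (suc m)} G H (s≤s (s≤s z≤n)) connected (s≤s (s≤s z≤n)) no-dominating-basis
          d (B , (B-gen , B-min) , ∣B∣≡d) =
  S , (S-gen , λ T T-gen → ≤-trans (≤-reflexive ∣S∣) (lower-bound T T-gen)) , ∣S∣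
  where
  open Corona G H
  S : Subset (suc (suc n) + suc (suc n) * suc (suc m))
  S = toSubset (rootless G H B)
  S-gen : IsAdjacencyGenerator (G ⊙ H) S
  S-gen = toSubset-isGenerator (rootless-isGenerator G H B-gen (adjacencyGenerator-nonempty H B-gen)
                                  (walk-neighbour (connected zero (suc zero)) (λ ())))
  ∣S∣ : ∣ S ∣ ≡ suc (suc n) * d + suc n
  ∣S∣ = trans (∣rootless∣ G H B) (cong (λ b → suc (suc n) * b + suc n) ∣B∣≡d)
  lower-bound : ∀ T → IsAdjacencyGenerator (G ⊙ H) T → suc (suc n) * d + suc n ≤ ∣ T ∣
  lower-bound = *+∸1≤∣adjacencyGenerator∣ G H d (λ T T-gen → subst (_≤ ∣ T ∣) ∣B∣≡d (B-min T T-gen))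
                                                no-dominating-basis
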